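{- For all $n,d,x$ for which the caterpillars below are defined, \begin{align*} W(G_{2}(n,d,x,1)) &= W(G_{2}(n,d,x,0))+1,\\ W(G_{2}(n,d,x,2)) &= W(G_{2}(n,d,x,0))+6,\\ W(G_{2}(n,d,x,-1)) &= W(G_{2}(n,d,x,0))+3. \end{align*}
   Context: For a connected graph $G$, $W(G)=\sum_{\{u,v\}\subseteq V(G)} d_G(u,v)$ (sum over unordered pairs). Caterpillar $B_2(m,d,x)$: for even $m\ge18$ and positive integers $d,x$ with $4\le d\le\lfloor m/4\rfloor$ and $x\le\frac{m-4d+2}{2}$, take the path $u_{ -d}\ldots u_{ -1}u_0u_1\ldots u_d$, append one leaf to each of $u_{ -(k-1)},\ldots,u_{k-1}$ where $k=d-1$, append $x$ leaves to each of $u_{ -(d-1)}$ and $u_{d-1}$, and append $r$ leaves to each of $u_{ -d}$ and $u_d$, where $r=\frac{m-4d-2x+2}{2}$. For even $n$ and integers $d,x$ for which $B_2(n-2,d,x)$ is defined, and $s\in\{ -1,0,1,2\}$, $G_2(n,d,x,s)$ is the caterpillar on $n$ vertices obtained from $B_2(n-2,d,x)$ by appending one leaf to $u_s$ and one leaf to $u_d$. -}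

module Defs where

open import Data.Nat using (ℕ; zero; suc; _+_; _*_; _∸_; _≡ᵇ_; _≤ᵇ_; _/_)
open import Data.Integer.Properties using () renaming (_≟_ to _≟ℤ_)
open import Relation.Nullary.Decidable using (⌊_⌋)
open import Data.Bool using (Bool; true; false; _∧_; _∨_; if_then_else_)
open import Data.List using (List; []; _∷_; _++_; map; upTo; concatMap)
open import Data.Nat.ListAction using (sum)
open import Data.Bool.ListAction using (any)
open import Data.Product using (_×_; _,_)
open import Data.Integer as ℤ using (ℤ; +_)

record Graph : Set where
  constructor graph
  field
    order : ℕ                 -- number of vertices N; vertices are 0 … N-1
    edges : List (ℕ × ℕ)

open Graph public

adj : Graph → ℕ → ℕ → Bool
adj G u v = any (λ e → edgeIs e) (edges G)
  where
  edgeIs : ℕ × ℕ → Bool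
  edgeIs (a , b) = ((a ≡ᵇ u) ∧ (b ≡ᵇ v)) ∨ ((a ≡ᵇ v) ∧ (b ≡ᵇ u))

within : Graph → ℕ → ℕ → ℕ → Bool
within G u v zero    = u ≡ᵇ v
within G u v (suc k) = within G u v k ∨ any (λ w → adj G u w ∧ within G w v k) (upTo (order G))

firstWithin : Graph → ℕ → ℕ → (start fuel : ℕ) → ℕ
firstWithin G u v start zero       = start
firstWithin G u v start (suc fuel) =
  if within G u v start then start else firstWithin G u v (suc start) fuel

-- graph distance d_G(u,v) = length of a shortest u–v walk/path.
-- In a connected graph on N vertices every distance is < N, so the
-- search over k = 0 … N finds it.
dist : Graph → ℕ → ℕ → ℕ
dist G u v = firstWithin G u v 0 (order G)

wiener : Graph → ℕ
wiener G = sum (concatMap (λ v → map (λ u → dist G u v) (upTo v)) (upTo (order G)))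

-- Caterpillars: spine u_{-d} … u_d (vertex i ↦ position i - d),
-- with f(j) pendant leaves attached to u_j.

pos : ℕ → ℕ → ℤ
pos d i = (+ i) ℤ.- (+ d)

leafEdges : ℕ → ℕ → ℕ → List (ℕ × ℕ)
leafEdges a next zero    = []
leafEdges a next (suc c) = (a , next) ∷ leafEdges a (suc next) c

allLeafEdges : (d : ℕ) → (ℤ → ℕ) → (i remaining next : ℕ) → List (ℕ × ℕ)
allLeafEdges d f i zero          next = []
allLeafEdges d f i (suc remaining) next =
  leafEdges i next (f (pos d i)) ++ allLeafEdges d f (suc i) remaining (next + f (pos d i))

spineEdges : ℕ → List (ℕ × ℕ)
spineEdges d = map (λ i → (i , suc i)) (upTo (2 * d))

totalLeaves : ℕ → (ℤ → ℕ) → ℕ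
totalLeaves d f = sum (map (λ i → f (pos d i)) (upTo (suc (2 * d))))

caterpillar : (d : ℕ) → (ℤ → ℕ) → Graph
caterpillar d f =
  graph (suc (2 * d) + totalLeaves d f)
        (spineEdges d ++ allLeafEdges d f 0 (suc (2 * d)) (suc (2 * d)))

rB : ℕ → ℕ → ℕ → ℕ
rB m d x = (m + 2 ∸ 4 * d ∸ 2 * x) / 2

-- leaf counts of B₂(m,d,x) at position j (k = d - 1):
--   one leaf at u_j for |j| ≤ k-1 = d-2, x leaves at |j| = d-1, r leaves at |j| = d
leavesB2 : ℕ → ℕ → ℕ → ℤ → ℕ
leavesB2 m d x j with ℤ.∣ j ∣
... | a = if a ≡ᵇ d then rB m d x
          else if a ≡ᵇ (d ∸ 1) then x
          else if a ≤ᵇ (d ∸ 2) then 1 else 0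

B₂ : ℕ → ℕ → ℕ → Graph
B₂ m d x = caterpillar d (leavesB2 m d x)

leavesG2 : ℕ → ℕ → ℕ → ℤ → ℤ → ℕ
leavesG2 n d x s j =
  leavesB2 (n ∸ 2) d x j
  + (if ⌊ j ≟ℤ s ⌋ then 1 else 0)
  + (if ⌊ j ≟ℤ (+ d) ⌋ then 1 else 0)

G₂ : ℕ → ℕ → ℕ → ℤ → Graph
G₂ n d x s = caterpillar d (leavesG2 n d x s)

-- In a caterpillar whose spine is the path 0, 1, …, L - 1 and whose other vertices are leaves
-- hanging on the spine, the distance between distinct vertices u and v is
-- depth u + depth v + ∣ base u - base v ∣, where base is the spine vertex a vertex hangs on and
-- depth is 0 on the spine and 1 on leaves.  The breadth-first search defining dist recovers
-- any function that vanishes exactly on the diagonal, is 1 on edges, satisfies the triangle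
-- inequality and always decreases by one along some edge; this one does.
--
-- Moving a single leaf ℓ from spine vertex p to p + 1 changes only the distances from ℓ, each by
-- one: it brings ℓ closer to the vertices hanging right of p and farther from the others.  So the
-- Wiener index changes by (number of vertices hanging on 0 … p, besides ℓ) minus (number hanging
-- on p + 1 … L - 1).  G₂(n,d,x,s+1) is G₂(n,d,x,s) with its extra leaf moved from u_s to u_(s+1),
-- and counting the leaves of B₂ on either side gives W(s+1) - W(s) = 4s + 1 for s = -1, 0, 1.

module Submission where

open import Data.Bool using (Bool; true; false; T; _∧_; _∨_; if_then_else_)
open import Data.Bool.ListAction using (any)
open import Data.Bool.Properties using (T-∧; T-∨)
open import Data.Integer as ℤ using (ℤ)
import Data.Integer.Properties as ℤₚ
open import Data.Nat.Divisibility using (_∣_)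
open import Data.List using (List; []; _∷_; map; concat; concatMap; applyUpTo; upTo)
open import Data.List.Membership.Propositional using (_∈_; find; lose)
open import Data.List.Membership.Propositional.Properties
  using (∈-upTo⁺; ∈-upTo⁻; ∈-++⁺ˡ; ∈-++⁺ʳ; ∈-++⁻; ∈-map⁺; ∈-map⁻)
open import Data.List.Properties using (map-applyUpTo)
open import Data.List.Relation.Unary.Any using (here; there)
open import Data.List.Relation.Unary.Any.Properties using (any⁺; any⁻)
open import Data.Nat
open import Data.Nat.ListAction using (sum)
open import Data.Nat.ListAction.Properties using (sum-++)
open import Data.Nat.Properties
open import Data.Nat.Solver using (module +-*-Solver)
open import Data.Product using (_×_; _,_; proj₁; proj₂; ∃-syntax)
open import Data.Sum using (_⊎_; inj₁; inj₂)
open import Function using (_∘_; _⇔_; mk⇔; Equivalence)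
open import Relation.Binary.PropositionalEquality
open import Relation.Binary.Definitions using (tri<; tri≈; tri>)
open import Relation.Nullary using (Dec; yes; no; ¬_; contradiction)
open import Relation.Nullary.Decidable using (⌊_⌋)

open import Defs

open +-*-Solver

∣m-n∣<o : ∀ {m n o} → m < o → n < o → ∣ m - n ∣ < o
∣m-n∣<o {m} {n} m<o n<o = ≤-<-trans (∣m-n∣≤m⊔n m n) (⊔-lub m<o n<o)

∣1+m-n∣≡1+∣m-n∣ : ∀ {m n} → n ≤ m → ∣ suc m - n ∣ ≡ suc ∣ m - n ∣
∣1+m-n∣≡1+∣m-n∣ {m}     {zero}  _         = cong suc (sym (∣-∣-identityʳ m))
∣1+m-n∣≡1+∣m-n∣ {suc m} {suc n} (s≤s n≤m) = ∣1+m-n∣≡1+∣m-n∣ n≤m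

∣m-n∣≡1+∣1+m-n∣ : ∀ {m n} → m < n → ∣ m - n ∣ ≡ suc ∣ suc m - n ∣
∣m-n∣≡1+∣1+m-n∣ {zero}  {suc n} _         = refl
∣m-n∣≡1+∣1+m-n∣ {suc m} {suc n} (s≤s m<n) = ∣m-n∣≡1+∣1+m-n∣ m<n

∣n-1+n∣≡1 : ∀ n → ∣ n - suc n ∣ ≡ 1
∣n-1+n∣≡1 zero    = refl
∣n-1+n∣≡1 (suc n) = ∣n-1+n∣≡1 n

∣m+n-m∣≡n : ∀ m n → ∣ m + n - m ∣ ≡ n
∣m+n-m∣≡n m n = trans (m≤n⇒∣n-m∣≡n∸m (m≤m+n m n)) (m+n∸m≡n m n)

cancel-offset : ∀ {u w} m n t → u + m ≡ w + n → n ≡ t + m → u ≡ w + t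
cancel-offset {u} {w} m n t eq n≡ = +-cancelʳ-≡ m u (w + t) (trans eq (trans (cong (w +_) n≡) (sym (+-assoc w t m))))

if-true : ∀ {A : Set} {b} {x y : A} → T b → (if b then x else y) ≡ x
if-true {b = true} _ = refl

if-false : ∀ {A : Set} {b} {x y : A} → ¬ T b → (if b then x else y) ≡ y
if-false {b = true}  ¬t = contradiction _ ¬t
if-false {b = false} _  = refl

∑ : (ℕ → ℕ) → ℕ → ℕ → ℕ
∑ f a zero    = 0
∑ f a (suc n) = f a + ∑ f (suc a) n

∑-shift : ∀ f a n → ∑ f (suc a) n ≡ ∑ (f ∘ suc) a n
∑-shift f a zero    = refl
∑-shift f a (suc n) = cong (f (suc a) +_) (∑-shift f (suc a) n)

∑-++ : ∀ f a m n → ∑ f a (m + n) ≡ ∑ f a m + ∑ f (a + m) n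
∑-++ f a zero    n rewrite +-identityʳ a = refl
∑-++ f a (suc m) n rewrite ∑-++ f (suc a) m n | +-suc a m = sym (+-assoc (f a) _ _)

∑-snoc : ∀ f a n → ∑ f a (suc n) ≡ ∑ f a n + f (a + n)
∑-snoc f a n = trans (cong (∑ f a) (+-comm 1 n)) (trans (∑-++ f a n 1) (cong (∑ f a n +_) (+-identityʳ _)))

∑-cong : ∀ {f g} a n → (∀ k → a ≤ k → k < a + n → f k ≡ g k) → ∑ f a n ≡ ∑ g a n
∑-cong a zero    eq = refl
∑-cong a (suc n) eq = cong₂ _+_ (eq a ≤-refl (m<m+n a z<s))
  (∑-cong (suc a) n λ k a<k k< → eq k (<⇒≤ a<k) (subst (k <_) (sym (+-suc a n)) k<))

∑-const : ∀ {f} a n v → (∀ k → a ≤ k → k < a + n → f k ≡ v) → ∑ f a n ≡ n * v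
∑-const a zero    v eq = refl
∑-const a (suc n) v eq = cong₂ _+_ (eq a ≤-refl (m<m+n a z<s))
  (∑-const (suc a) n v λ k a<k k< → eq k (<⇒≤ a<k) (subst (k <_) (sym (+-suc a n)) k<))

∑-+ : ∀ f g a n → ∑ (λ k → f k + g k) a n ≡ ∑ f a n + ∑ g a n
∑-+ f g a zero    = refl
∑-+ f g a (suc n) rewrite ∑-+ f g (suc a) n =
  solve 4 (λ p q r s → p :+ q :+ (r :+ s) := p :+ r :+ (q :+ s)) refl (f a) (g a) (∑ f (suc a) n) (∑ g (suc a) n)

∑-suc : ∀ f a n → ∑ (suc ∘ f) a n ≡ n + ∑ f a n
∑-suc f a zero    = refl
∑-suc f a (suc n) = cong suc (trans (cong (f a +_) (∑-suc f (suc a) n))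
  (solve 3 (λ x m y → x :+ (m :+ y) := m :+ (x :+ y)) refl (f a) n (∑ f (suc a) n)))

∑-update : ∀ {F F'} a n ℓ → a ≤ ℓ → ℓ < a + n → (∀ k → k ≢ ℓ → F' k ≡ F k) →
           ∑ F' a n + F ℓ ≡ ∑ F a n + F' ℓ
∑-update a zero ℓ a≤ℓ ℓ< eq = contradiction (subst (ℓ <_) (+-identityʳ a) ℓ<) (≤⇒≯ a≤ℓ)
∑-update {F} {F'} a (suc n) ℓ a≤ℓ ℓ< eq with a ≟ ℓ
... | yes refl rewrite ∑-cong {F'} {F} (suc a) n (λ k a<k _ → eq k (>⇒≢ a<k)) =
  solve 3 (λ x y z → x :+ y :+ z := z :+ y :+ x) refl (F' a) (∑ F (suc a) n) (F a)
... | no a≢ℓ rewrite +-assoc (F' a) (∑ F' (suc a) n) (F ℓ) | eq a a≢ℓ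
                   | ∑-update (suc a) n ℓ (≤∧≢⇒< a≤ℓ a≢ℓ) (subst (ℓ <_) (+-suc a n) ℓ<) eq =
  sym (+-assoc (F a) _ _)

sum-applyUpTo : ∀ f n → sum (applyUpTo f n) ≡ ∑ f 0 n
sum-applyUpTo f zero    = refl
sum-applyUpTo f (suc n) = cong (f 0 +_) (trans (sum-applyUpTo (f ∘ suc) n) (sym (∑-shift f 0 n)))

sum-map-upTo : ∀ f n → sum (map f (upTo n)) ≡ ∑ f 0 n
sum-map-upTo f n = trans (cong sum (map-applyUpTo (λ i → i) f n)) (sum-applyUpTo f n)

sum-concatMap : ∀ {A : Set} (F : A → List ℕ) xs → sum (concatMap F xs) ≡ sum (map (sum ∘ F) xs)
sum-concatMap F []       = refl
sum-concatMap F (x ∷ xs) = trans (sum-++ (F x) (concat (map F xs))) (cong (sum (F x) +_) (sum-concatMap F xs))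

𝟙 : {P : Set} → Dec P → ℕ
𝟙 (yes _) = 1
𝟙 (no _)  = 0

𝟙-yes : ∀ {P : Set} (P? : Dec P) → P → 𝟙 P? ≡ 1
𝟙-yes (yes _) _ = refl
𝟙-yes (no ¬p) p = contradiction p ¬p

𝟙-no : ∀ {P : Set} (P? : Dec P) → ¬ P → 𝟙 P? ≡ 0
𝟙-no (yes p) ¬p = contradiction p ¬p
𝟙-no (no _)  _  = refl

δ : ℕ → ℕ → ℕ
δ j i = 𝟙 (i ≟ j)

δ-self : ∀ {i j} → i ≡ j → δ j i ≡ 1
δ-self {i} {j} = 𝟙-yes (i ≟ j)

δ-other : ∀ {i j} → i ≢ j → δ j i ≡ 0
δ-other {i} {j} = 𝟙-no (i ≟ j)

∑-δ-out : ∀ j a n → j < a ⊎ a + n ≤ j → ∑ (δ j) a n ≡ 0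
∑-δ-out j a n out = trans (∑-const a n 0 λ k a≤k k< → 𝟙-no (k ≟ j) (outside out a≤k k<)) (*-zeroʳ n)
  where
  outside : ∀ {k} → j < a ⊎ a + n ≤ j → a ≤ k → k < a + n → k ≢ j
  outside (inj₁ j<a) a≤k _  refl = <⇒≱ j<a a≤k
  outside (inj₂ a+n≤j) _ k< refl = <⇒≱ k< a+n≤j

∑-δ-in : ∀ j a n → a ≤ j → j < a + n → ∑ (δ j) a n ≡ 1
∑-δ-in j a zero    a≤j j< = contradiction (subst (j <_) (+-identityʳ a) j<) (≤⇒≯ a≤j)
∑-δ-in j a (suc n) a≤j j< with a ≟ j
... | yes refl = cong suc (∑-δ-out a (suc a) n (inj₁ ≤-refl))
... | no a≢j   = ∑-δ-in j (suc a) n (≤∧≢⇒< a≤j a≢j) (subst (j <_) (+-suc a n) j<)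

∑-*𝟙-≤ : ∀ g p n → p < n → ∑ (λ i → g i * 𝟙 (i ≤? p)) 0 n ≡ ∑ g 0 (suc p)
∑-*𝟙-≤ g p n p<n = begin
  ∑ F 0 n                                      ≡⟨ cong (∑ F 0) (sym (m+[n∸m]≡n p<n)) ⟩
  ∑ F 0 (suc p + (n ∸ suc p))                  ≡⟨ ∑-++ F 0 (suc p) (n ∸ suc p) ⟩
  ∑ F 0 (suc p) + ∑ F (suc p) (n ∸ suc p)      ≡⟨ cong₂ _+_ (∑-cong 0 (suc p) λ i _ i≤p → selected i (s≤s⁻¹ i≤p))
                                                          (∑-const (suc p) (n ∸ suc p) 0 λ i p<i _ → dropped i p<i) ⟩
  ∑ g 0 (suc p) + (n ∸ suc p) * 0              ≡⟨ cong (∑ g 0 (suc p) +_) (*-zeroʳ (n ∸ suc p)) ⟩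
  ∑ g 0 (suc p) + 0                            ≡⟨ +-identityʳ _ ⟩
  ∑ g 0 (suc p)                                ∎
  where
  open ≡-Reasoning
  F : ℕ → ℕ
  F i = g i * 𝟙 (i ≤? p)
  selected : ∀ i → i ≤ p → F i ≡ g i
  selected i i≤p = trans (cong (g i *_) (𝟙-yes (i ≤? p) i≤p)) (*-identityʳ (g i))
  dropped : ∀ i → p < i → F i ≡ 0
  dropped i p<i = trans (cong (g i *_) (𝟙-no (i ≤? p) (<⇒≱ p<i))) (*-zeroʳ (g i))

∑-*𝟙-> : ∀ g p n → p < n → ∑ (λ i → g i * 𝟙 (p <? i)) 0 n ≡ ∑ g (suc p) (n ∸ suc p)
∑-*𝟙-> g p n p<n = begin
  ∑ F 0 n                                      ≡⟨ cong (∑ F 0) (sym (m+[n∸m]≡n p<n)) ⟩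
  ∑ F 0 (suc p + (n ∸ suc p))                  ≡⟨ ∑-++ F 0 (suc p) (n ∸ suc p) ⟩
  ∑ F 0 (suc p) + ∑ F (suc p) (n ∸ suc p)      ≡⟨ cong₂ _+_ (∑-const 0 (suc p) 0 λ i _ i≤p → dropped i (s≤s⁻¹ i≤p))
                                                          (∑-cong (suc p) (n ∸ suc p) λ i p<i _ → selected i p<i) ⟩
  suc p * 0 + ∑ g (suc p) (n ∸ suc p)          ≡⟨ cong (_+ ∑ g (suc p) (n ∸ suc p)) (*-zeroʳ (suc p)) ⟩
  ∑ g (suc p) (n ∸ suc p)                      ∎
  where
  open ≡-Reasoning
  F : ℕ → ℕ
  F i = g i * 𝟙 (p <? i)
  selected : ∀ i → p < i → F i ≡ g i
  selected i p<i = trans (cong (g i *_) (𝟙-yes (p <? i) p<i)) (*-identityʳ (g i))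
  dropped : ∀ i → i ≤ p → F i ≡ 0
  dropped i i≤p = trans (cong (g i *_) (𝟙-no (p <? i) (≤⇒≯ i≤p))) (*-zeroʳ (g i))

∑< : (ℕ → ℕ → ℕ) → ℕ → ℕ
∑< g n = ∑ (λ v → ∑ (λ u → g u v) 0 v) 0 n

∑<-cong : ∀ {g g'} n → (∀ u v → u < v → v < n → g' u v ≡ g u v) → ∑< g' n ≡ ∑< g n
∑<-cong n eq = ∑-cong 0 n λ v _ v<n → ∑-cong 0 v λ u _ u<v → eq u v u<v v<n

-- Both sides consist of the pairs avoiding ℓ, on which g and g' agree, plus the row of ℓ.
∑<-update : ∀ {g g'} ℓ n → (∀ u v → g u v ≡ g v u) → (∀ u v → g' u v ≡ g' v u) →
            (∀ u v → u ≢ ℓ → v ≢ ℓ → g' u v ≡ g u v) → g ℓ ℓ ≡ 0 → g' ℓ ℓ ≡ 0 → ℓ < n →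
            ∑< g' n + ∑ (g ℓ) 0 n ≡ ∑< g n + ∑ (g' ℓ) 0 n
∑<-update {g} {g'} ℓ (suc m) sym-g sym-g' eq gℓℓ g'ℓℓ ℓ≤m with ℓ ≟ m
... | yes refl = begin
  ∑< g' (suc ℓ) + ∑ (g ℓ) 0 (suc ℓ)
    ≡⟨ cong₂ _+_ (∑-snoc _ 0 ℓ) (∑-snoc _ 0 ℓ) ⟩
  ∑< g' ℓ + ∑ (λ u → g' u ℓ) 0 ℓ + (∑ (g ℓ) 0 ℓ + g ℓ ℓ)
    ≡⟨ cong₂ (λ s t → s + t + (∑ (g ℓ) 0 ℓ + g ℓ ℓ)) above column' ⟩
  ∑< g ℓ + ∑ (g' ℓ) 0 ℓ + (∑ (g ℓ) 0 ℓ + g ℓ ℓ)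
    ≡⟨ cong (λ z → ∑< g ℓ + ∑ (g' ℓ) 0 ℓ + (∑ (g ℓ) 0 ℓ + z)) (trans gℓℓ (sym g'ℓℓ)) ⟩
  ∑< g ℓ + ∑ (g' ℓ) 0 ℓ + (∑ (g ℓ) 0 ℓ + g' ℓ ℓ)
    ≡⟨ solve 4 (λ a b c e → a :+ b :+ (c :+ e) := a :+ c :+ (b :+ e)) refl (∑< g ℓ) _ _ _ ⟩
  ∑< g ℓ + ∑ (g ℓ) 0 ℓ + (∑ (g' ℓ) 0 ℓ + g' ℓ ℓ)
    ≡⟨ cong₂ _+_ (cong (∑< g ℓ +_) (sym column)) (sym (∑-snoc _ 0 ℓ)) ⟩
  ∑< g ℓ + ∑ (λ u → g u ℓ) 0 ℓ + ∑ (g' ℓ) 0 (suc ℓ)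
    ≡⟨ cong (_+ ∑ (g' ℓ) 0 (suc ℓ)) (sym (∑-snoc _ 0 ℓ)) ⟩
  ∑< g (suc ℓ) + ∑ (g' ℓ) 0 (suc ℓ)
    ∎
  where
  open ≡-Reasoning
  above : ∑< g' ℓ ≡ ∑< g ℓ
  above = ∑<-cong ℓ λ u v u<v v<ℓ → eq u v (<⇒≢ (<-trans u<v v<ℓ)) (<⇒≢ v<ℓ)
  column' : ∑ (λ u → g' u ℓ) 0 ℓ ≡ ∑ (g' ℓ) 0 ℓ
  column' = ∑-cong 0 ℓ λ u _ _ → sym-g' u ℓ
  column : ∑ (λ u → g u ℓ) 0 ℓ ≡ ∑ (g ℓ) 0 ℓ
  column = ∑-cong 0 ℓ λ u _ _ → sym-g u ℓ
... | no ℓ≢m = begin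
  ∑< g' (suc m) + ∑ (g ℓ) 0 (suc m)
    ≡⟨ cong₂ _+_ (∑-snoc _ 0 m) (∑-snoc _ 0 m) ⟩
  ∑< g' m + ∑ (λ u → g' u m) 0 m + (∑ (g ℓ) 0 m + g ℓ m)
    ≡⟨ interchange (∑< g' m) _ _ _ ⟩
  (∑< g' m + ∑ (g ℓ) 0 m) + (∑ (λ u → g' u m) 0 m + g ℓ m)
    ≡⟨ cong₂ _+_ (∑<-update ℓ m sym-g sym-g' eq gℓℓ g'ℓℓ ℓ<m) column ⟩
  (∑< g m + ∑ (g' ℓ) 0 m) + (∑ (λ u → g u m) 0 m + g' ℓ m)
    ≡⟨ sym (interchange (∑< g m) _ _ _) ⟩
  ∑< g m + ∑ (λ u → g u m) 0 m + (∑ (g' ℓ) 0 m + g' ℓ m)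
    ≡⟨ sym (cong₂ _+_ (∑-snoc _ 0 m) (∑-snoc _ 0 m)) ⟩
  ∑< g (suc m) + ∑ (g' ℓ) 0 (suc m)
    ∎
  where
  open ≡-Reasoning
  ℓ<m : ℓ < m
  ℓ<m = ≤∧≢⇒< (s≤s⁻¹ ℓ≤m) ℓ≢m
  interchange : ∀ a b c e → a + b + (c + e) ≡ (a + c) + (b + e)
  interchange = solve 4 (λ a b c e → a :+ b :+ (c :+ e) := (a :+ c) :+ (b :+ e)) refl
  column : ∑ (λ u → g' u m) 0 m + g ℓ m ≡ ∑ (λ u → g u m) 0 m + g' ℓ m
  column = ∑-update 0 m ℓ z≤n ℓ<m λ u u≢ℓ → eq u m u≢ℓ (ℓ≢m ∘ sym)

wiener≡∑<dist : ∀ G → wiener G ≡ ∑< (dist G) (order G)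
wiener≡∑<dist G = begin
  wiener G                                                       ≡⟨ sum-concatMap column (upTo (order G)) ⟩
  sum (map (sum ∘ column) (upTo (order G)))                      ≡⟨ sum-map-upTo (sum ∘ column) (order G) ⟩
  ∑ (sum ∘ column) 0 (order G)                                   ≡⟨ ∑-cong 0 (order G) (λ v _ _ → sum-map-upTo (λ u → dist G u v) v) ⟩
  ∑< (dist G) (order G)                                          ∎
  where
  open ≡-Reasoning
  column : ℕ → List ℕ
  column v = map (λ u → dist G u v) (upTo v)

firstWithin≡ : ∀ G {u v t} → (∀ k → T (within G u v k) ⇔ t ≤ k) →
               ∀ s fuel → s ≤ t → t < s + fuel → firstWithin G u v s fuel ≡ t
firstWithin≡ G W s zero s≤t t< = contradiction (subst (_ <_) (+-identityʳ s) t<) (≤⇒≯ s≤t)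
firstWithin≡ G {u} {v} {t} W s (suc fuel) s≤t t< with within G u v s | Equivalence.to (W s) | Equivalence.from (W s)
... | true  | reached | _ = ≤-antisym s≤t (reached _)
... | false | _ | unreached =
  firstWithin≡ G W (suc s) fuel (≤∧≢⇒< s≤t λ s≡t → unreached (≤-reflexive (sym s≡t))) (subst (t <_) (+-suc s fuel) t<)

module Geodesic (G : Graph) (ρ : ℕ → ℕ → ℕ)
  (ρ-refl : ∀ u → ρ u u ≡ 0)
  (ρ-definite : ∀ {u v} → ρ u v ≡ 0 → u ≡ v)
  (ρ-triangle : ∀ u w v → ρ u v ≤ ρ u w + ρ w v)
  (ρ-adj : ∀ {u w} → T (adj G u w) → ρ u w ≡ 1)
  (ρ-descent : ∀ {u v} → u < order G → v < order G → u ≢ v →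
               ∃[ w ] w < order G × T (adj G u w) × ρ u v ≡ suc (ρ w v))
  (ρ-bounded : ∀ {u v} → u < order G → v < order G → ρ u v < order G)
  where

  within⇔ : ∀ k {u v} → u < order G → v < order G → T (within G u v k) ⇔ ρ u v ≤ k
  within⇔ zero {u} {v} _ _ = mk⇔
    (λ u≡ᵇv → ≤-reflexive (trans (cong (ρ u) (sym (≡ᵇ⇒≡ u v u≡ᵇv))) (ρ-refl u)))
    (λ ρ≤0 → ≡⇒≡ᵇ u v (ρ-definite (n≤0⇒n≡0 ρ≤0)))
  within⇔ (suc k) {u} {v} u< v< = mk⇔ to from
    where
    step : ℕ → Bool
    step w = adj G u w ∧ within G w v k

    to : T (within G u v k ∨ any step (upTo (order G))) → ρ u v ≤ suc k
    to t with Equivalence.to T-∨ t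
    ... | inj₁ near = m≤n⇒m≤1+n (Equivalence.to (within⇔ k u< v<) near)
    ... | inj₂ far with find (any⁻ step (upTo (order G)) far)
    ... | w , w∈ , tw with Equivalence.to T-∧ tw
    ... | u~w , near = begin
      ρ u v         ≤⟨ ρ-triangle u w v ⟩
      ρ u w + ρ w v ≡⟨ cong (_+ ρ w v) (ρ-adj u~w) ⟩
      suc (ρ w v)   ≤⟨ s≤s (Equivalence.to (within⇔ k (∈-upTo⁻ w∈) v<) near) ⟩
      suc k         ∎
      where open ≤-Reasoning

    from : ρ u v ≤ suc k → T (within G u v k ∨ any step (upTo (order G)))
    from ρ≤ with ρ u v ≤? k
    ... | yes ρ≤k = Equivalence.from T-∨ (inj₁ (Equivalence.from (within⇔ k u< v<) ρ≤k))
    ... | no ρ≰k with ρ-descent u< v< u≢v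
      where
      u≢v : u ≢ v
      u≢v refl = ρ≰k (subst (_≤ k) (sym (ρ-refl u)) z≤n)
    ... | w , w< , u~w , ρ≡ = Equivalence.from T-∨ (inj₂ (any⁺ step (lose (∈-upTo⁺ w<)
            (Equivalence.from T-∧ (u~w , Equivalence.from (within⇔ k w< v<) ρwv≤k)))))
      where
      ρwv≤k : ρ w v ≤ k
      ρwv≤k = s≤s⁻¹ (subst (_≤ suc k) ρ≡ ρ≤)

  dist≡ρ : ∀ {u v} → u < order G → v < order G → dist G u v ≡ ρ u v
  dist≡ρ u< v< = firstWithin≡ G (λ k → within⇔ k u< v<) 0 (order G) z≤n (ρ-bounded u< v<)

  wiener≡∑<ρ : wiener G ≡ ∑< ρ (order G)
  wiener≡∑<ρ = trans (wiener≡∑<dist G) (∑<-cong (order G) λ u v u<v v< → dist≡ρ (<-trans u<v v<) v<)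

-- Vertices below L form the spine; any other vertex v is a leaf hanging on the spine vertex foot v.
module SpineMetric (L : ℕ) where

  depth : ℕ → ℕ
  depth v with v <? L
  ... | yes _ = 0
  ... | no  _ = 1

  depth-spine : ∀ {v} → v < L → depth v ≡ 0
  depth-spine {v} v<L with v <? L
  ... | yes _ = refl
  ... | no v≮L = contradiction v<L v≮L

  depth-leaf : ∀ {v} → L ≤ v → depth v ≡ 1
  depth-leaf {v} L≤v with v <? L
  ... | yes v<L = contradiction L≤v (<⇒≱ v<L)
  ... | no  _   = refl

  module _ (foot : ℕ → ℕ) where

    base : ℕ → ℕ
    base v with v <? L
    ... | yes _ = v
    ... | no  _ = foot v

    base-spine : ∀ {v} → v < L → base v ≡ v
    base-spine {v} v<L with v <? L
    ... | yes _ = refl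
    ... | no v≮L = contradiction v<L v≮L

    base-leaf : ∀ {v} → L ≤ v → base v ≡ foot v
    base-leaf {v} L≤v with v <? L
    ... | yes v<L = contradiction L≤v (<⇒≱ v<L)
    ... | no  _   = refl

    ρ : ℕ → ℕ → ℕ
    ρ u v with u ≟ v
    ... | yes _ = 0
    ... | no  _ = depth u + depth v + ∣ base u - base v ∣

    ρ-refl : ∀ u → ρ u u ≡ 0
    ρ-refl u with u ≟ u
    ... | yes _  = refl
    ... | no u≢u = contradiction refl u≢u

    ρ-off : ∀ {u v} → u ≢ v → ρ u v ≡ depth u + depth v + ∣ base u - base v ∣
    ρ-off {u} {v} u≢v with u ≟ v
    ... | yes u≡v = contradiction u≡v u≢v
    ... | no  _   = refl

    ρ-sym : ∀ u v → ρ u v ≡ ρ v u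
    ρ-sym u v with u ≟ v
    ... | yes refl = sym (ρ-refl u)
    ... | no  u≢v  = trans (cong₂ _+_ (+-comm (depth u) (depth v)) (∣-∣-comm (base u) (base v)))
                           (sym (ρ-off (u≢v ∘ sym)))

    ρ-definite : ∀ {u v} → ρ u v ≡ 0 → u ≡ v
    ρ-definite {u} {v} ρ≡0 with u ≟ v
    ... | yes u≡v = u≡v
    ... | no  _ with u <? L | v <? L
    ...   | yes _ | yes _ = ∣m-n∣≡0⇒m≡n ρ≡0
    ...   | no  _ | _     = contradiction ρ≡0 λ ()
    ...   | yes _ | no  _ = contradiction ρ≡0 λ ()

    ρ-from-spine : ∀ {u v} → u < L → u ≢ v → ρ u v ≡ depth v + ∣ u - base v ∣
    ρ-from-spine {u} {v} u<L u≢v rewrite ρ-off u≢v | depth-spine u<L | base-spine u<L = refl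

    ρ-from-leaf : ∀ {u v} → L ≤ u → u ≢ v → ρ u v ≡ suc (depth v + ∣ foot u - base v ∣)
    ρ-from-leaf {u} {v} L≤u u≢v rewrite ρ-off u≢v | depth-leaf L≤u | base-leaf L≤u = refl

    ρ-toward : ∀ {u w v} → u < L → w < L → u ≢ v → ∣ u - base v ∣ ≡ suc ∣ w - base v ∣ → ρ u v ≡ suc (ρ w v)
    ρ-toward {u} {w} {v} u<L w<L u≢v gap with w ≟ v
    ... | yes refl rewrite ρ-from-spine u<L u≢v | depth-spine w<L | base-spine w<L | ∣n-n∣≡0 w = gap
    ... | no w≢v rewrite ρ-from-spine u<L u≢v | depth-spine w<L | base-spine w<L | gap = +-suc (depth v) _

    ρ-to-own-leaf : ∀ {u v} → u < L → L ≤ v → foot v ≡ u → ρ u v ≡ 1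
    ρ-to-own-leaf {u} {v} u<L L≤v foot-v≡u
      rewrite ρ-from-spine u<L (<⇒≢ (<-≤-trans u<L L≤v)) | depth-leaf L≤v | base-leaf L≤v | foot-v≡u | ∣n-n∣≡0 u = refl

    ρ-triangle : ∀ u w v → ρ u v ≤ ρ u w + ρ w v
    ρ-triangle u w v with u ≟ w
    ... | yes refl = ≤-refl
    ... | no u≢w with w ≟ v
    ...   | yes refl = ≤-reflexive (trans (ρ-off u≢w) (sym (+-identityʳ _)))
    ...   | no _ with u ≟ v
    ...     | yes _ = z≤n
    ...     | no  _ = begin
      depth u + depth v + ∣ base u - base v ∣
        ≤⟨ +-monoʳ-≤ (depth u + depth v) (∣-∣-triangle (base u) (base w) (base v)) ⟩
      depth u + depth v + (∣ base u - base w ∣ + ∣ base w - base v ∣)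
        ≤⟨ m≤m+n _ (depth w + depth w) ⟩
      depth u + depth v + (∣ base u - base w ∣ + ∣ base w - base v ∣) + (depth w + depth w)
        ≡⟨ solve 5 (λ a b e x y → a :+ b :+ (x :+ y) :+ (e :+ e) := a :+ e :+ x :+ (e :+ b :+ y)) refl
             (depth u) (depth v) (depth w) ∣ base u - base w ∣ ∣ base w - base v ∣ ⟩
      depth u + depth w + ∣ base u - base w ∣ + (depth w + depth v + ∣ base w - base v ∣) ∎
      where open ≤-Reasoning

    module _ (foot<L : ∀ v → foot v < L) where

      base<L : ∀ v → base v < L
      base<L v with v <? L
      ... | yes v<L = v<L
      ... | no  _   = foot<L v

      ρ-leaf-descent : ∀ {u v} → L ≤ u → u ≢ v → ρ u v ≡ suc (ρ (foot u) v)
      ρ-leaf-descent {u} {v} L≤u u≢v with foot u ≟ v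
      ... | yes refl rewrite ρ-from-leaf L≤u u≢v | depth-spine (foot<L u) | base-spine (foot<L u) | ∣n-n∣≡0 (foot u) = refl
      ... | no  _    rewrite ρ-from-leaf L≤u u≢v | depth-spine (foot<L u) | base-spine (foot<L u) = refl

      ρ-bounded : ∀ {N u v} → L ≤ N → u < N → v < N → ρ u v < N
      ρ-bounded {N} {u} {v} L≤N u<N v<N with u ≟ v
      ... | yes _   = ≤-<-trans z≤n u<N
      ... | no  u≢v with u <? L | v <? L | ∣m-n∣<o (base<L u) (base<L v)
      ...   | yes _   | yes _   | gap<L = <-≤-trans gap<L L≤N
      ...   | no  u≮L | yes _   | gap<L = ≤-<-trans (<-≤-trans gap<L (≮⇒≥ u≮L)) u<N
      ...   | yes _   | no  v≮L | gap<L = ≤-<-trans (<-≤-trans gap<L (≮⇒≥ v≮L)) v<N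
      ...   | no  u≮L | no  v≮L | gap<L with <-cmp u v
      ...     | tri< u<v _ _ = ≤-<-trans (<-≤-trans (s≤s gap<L) (≤-trans (s≤s (≮⇒≥ u≮L)) u<v)) v<N
      ...     | tri≈ _ u≡v _ = contradiction u≡v u≢v
      ...     | tri> _ _ v<u = ≤-<-trans (<-≤-trans (s≤s gap<L) (≤-trans (s≤s (≮⇒≥ v≮L)) v<u)) u<N

  module _ {foot foot' : ℕ → ℕ} {ℓ p : ℕ} (L≤ℓ : L ≤ ℓ) (footℓ : foot ℓ ≡ p) (foot'ℓ : foot' ℓ ≡ suc p)
           (foot'≡foot : ∀ v → v ≢ ℓ → foot' v ≡ foot v) where

    private
      baseℓ : base foot ℓ ≡ p
      baseℓ = trans (base-leaf foot L≤ℓ) footℓ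

      base'ℓ : base foot' ℓ ≡ suc p
      base'ℓ = trans (base-leaf foot' L≤ℓ) foot'ℓ

      base'≡base : ∀ v → v ≢ ℓ → base foot' v ≡ base foot v
      base'≡base v v≢ℓ with v <? L
      ... | yes _ = refl
      ... | no  _ = foot'≡foot v v≢ℓ

      ρ'≡ρ : ∀ u v → u ≢ ℓ → v ≢ ℓ → ρ foot' u v ≡ ρ foot u v
      ρ'≡ρ u v u≢ℓ v≢ℓ with u ≟ v
      ... | yes _ = refl
      ... | no  _ = cong₂ (λ a b → depth u + depth v + ∣ a - b ∣) (base'≡base u u≢ℓ) (base'≡base v v≢ℓ)

      moved-row : ∀ v → ρ foot' ℓ v + 𝟙 (p <? base foot v) + δ ℓ v ≡ ρ foot ℓ v + 𝟙 (base foot v ≤? p)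
      moved-row v with v ≟ ℓ
      ... | yes refl rewrite ρ-refl foot ℓ | ρ-refl foot' ℓ | baseℓ
                           | 𝟙-no (p <? p) (n≮n p) | 𝟙-yes (p ≤? p) ≤-refl = refl
      ... | no v≢ℓ rewrite ρ-off foot' (v≢ℓ ∘ sym) | ρ-off foot (v≢ℓ ∘ sym) | base'ℓ | baseℓ
                         | base'≡base v v≢ℓ with base foot v ≤? p
      ...   | yes b≤p rewrite 𝟙-no (p <? base foot v) (≤⇒≯ b≤p) | ∣1+m-n∣≡1+∣m-n∣ b≤p =
        solve 3 (λ a b x → a :+ b :+ (con 1 :+ x) :+ con 0 :+ con 0 := a :+ b :+ x :+ con 1) refl
          (depth ℓ) (depth v) ∣ p - base foot v ∣
      ...   | no  b≰p rewrite 𝟙-yes (p <? base foot v) (≰⇒> b≰p) | ∣m-n∣≡1+∣1+m-n∣ (≰⇒> b≰p) =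
        solve 3 (λ a b x → a :+ b :+ x :+ con 1 :+ con 0 := a :+ b :+ (con 1 :+ x) :+ con 0) refl
          (depth ℓ) (depth v) ∣ suc p - base foot v ∣

    -- ℓ itself hangs on p and is counted on the right; this is the + 1 on the left.
    ∑<ρ-transfer : ∀ {N} → ℓ < N →
      ∑< (ρ foot') N + ∑ (λ v → 𝟙 (p <? base foot v)) 0 N + 1 ≡ ∑< (ρ foot) N + ∑ (λ v → 𝟙 (base foot v ≤? p)) 0 N
    ∑<ρ-transfer {N} ℓ<N = +-cancelˡ-≡ S _ _ (begin
      S + (W' + Gt + 1)   ≡⟨ solve 4 (λ s w g o → s :+ (w :+ g :+ o) := w :+ s :+ (g :+ o)) refl S W' Gt 1 ⟩
      W' + S + (Gt + 1)   ≡⟨ cong (_+ (Gt + 1)) (∑<-update ℓ N (ρ-sym foot) (ρ-sym foot') ρ'≡ρ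
                                                  (ρ-refl foot ℓ) (ρ-refl foot' ℓ) ℓ<N) ⟩
      W + S' + (Gt + 1)   ≡⟨ solve 4 (λ w s g o → w :+ s :+ (g :+ o) := w :+ (s :+ g :+ o)) refl W S' Gt 1 ⟩
      W + (S' + Gt + 1)   ≡⟨ cong (W +_) rows ⟩
      W + (S + Le)        ≡⟨ solve 3 (λ w s l → w :+ (s :+ l) := s :+ (w :+ l)) refl W S Le ⟩
      S + (W + Le)        ∎)
      where
      open ≡-Reasoning
      W  = ∑< (ρ foot) N
      W' = ∑< (ρ foot') N
      S  = ∑ (ρ foot ℓ) 0 N
      S' = ∑ (ρ foot' ℓ) 0 N
      Gt = ∑ (λ v → 𝟙 (p <? base foot v)) 0 N
      Le = ∑ (λ v → 𝟙 (base foot v ≤? p)) 0 N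
      rows : S' + Gt + 1 ≡ S + Le
      rows = begin
        S' + Gt + 1                                                     ≡⟨ cong (S' + Gt +_) (sym (∑-δ-in ℓ 0 N z≤n ℓ<N)) ⟩
        S' + Gt + ∑ (δ ℓ) 0 N                                           ≡⟨ cong (_+ ∑ (δ ℓ) 0 N) (sym (∑-+ (ρ foot' ℓ) _ 0 N)) ⟩
        ∑ (λ v → ρ foot' ℓ v + 𝟙 (p <? base foot v)) 0 N + ∑ (δ ℓ) 0 N ≡⟨ sym (∑-+ _ (δ ℓ) 0 N) ⟩
        ∑ (λ v → ρ foot' ℓ v + 𝟙 (p <? base foot v) + δ ℓ v) 0 N        ≡⟨ ∑-cong 0 N (λ v _ _ → moved-row v) ⟩
        ∑ (λ v → ρ foot ℓ v + 𝟙 (base foot v ≤? p)) 0 N                  ≡⟨ ∑-+ (ρ foot ℓ) _ 0 N ⟩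
        S + Le                                                          ∎

-- Leaves next, next + 1, … are hung c i at a time on the spine vertices i, i + 1, …, as in
-- allLeafEdges; attach returns the spine vertex carrying leaf v (junk value 0 past the last leaf).
attach : (ℕ → ℕ) → (i rem next v : ℕ) → ℕ
attach c i zero      next v = 0
attach c i (suc rem) next v with v <? next + c i
... | yes _ = i
... | no  _ = attach c (suc i) rem (next + c i) v

module _ (c : ℕ → ℕ) where

  attach-here : ∀ i rem next {v} → v < next + c i → attach c i (suc rem) next v ≡ i
  attach-here i rem next {v} v< with v <? next + c i
  ... | yes _ = refl
  ... | no v≮ = contradiction v< v≮

  attach-later : ∀ i rem next {v} → next + c i ≤ v → attach c i (suc rem) next v ≡ attach c (suc i) rem (next + c i) v
  attach-later i rem next {v} ≤v with v <? next + c i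
  ... | yes v< = contradiction ≤v (<⇒≱ v<)
  ... | no  _  = refl

  attach<B : ∀ {B} i rem next v → i + rem ≤ B → 0 < B → attach c i rem next v < B
  attach<B i zero      next v _ 0<B = 0<B
  attach<B {B} i (suc rem) next v i+rem≤B 0<B with v <? next + c i
  ... | yes _ = ≤-trans (s≤s (m≤m+n i rem)) (subst (_≤ B) (+-suc i rem) i+rem≤B)
  ... | no  _ = attach<B (suc i) rem (next + c i) v (subst (_≤ B) (+-suc i rem) i+rem≤B) 0<B

  attach-at : ∀ k {i R next v} → next + ∑ c i k ≤ v → v < next + ∑ c i k + c (k + i) →
              attach c i (k + suc R) next v ≡ k + i
  attach-at zero {i} {R} {next} {v} ≤v v< = attach-here i R next (subst (λ m → v < m + c i) (+-identityʳ next) v<)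
  attach-at (suc k) {i} {R} {next} {v} ≤v v< =
    trans (attach-later i (k + suc R) next (≤-trans (m≤m+n (next + c i) (∑ c (suc i) k)) ≤v'))
          (trans (attach-at k ≤v' v<') (+-suc k i))
    where
    ≤v' : next + c i + ∑ c (suc i) k ≤ v
    ≤v' = subst (_≤ v) (sym (+-assoc next (c i) _)) ≤v
    v<' : v < next + c i + ∑ c (suc i) k + c (k + suc i)
    v<' = subst (v <_) (cong₂ _+_ (sym (+-assoc next (c i) _)) (cong c (sym (+-suc k i)))) v<

  ∑-attach : ∀ (φ : ℕ → ℕ) i rem next →
             ∑ (φ ∘ attach c i rem next) next (∑ c i rem) ≡ ∑ (λ k → c k * φ k) i rem
  ∑-attach φ i zero      next = refl
  ∑-attach φ i (suc rem) next = begin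
    ∑ F next (c i + ∑ c (suc i) rem)                       ≡⟨ ∑-++ F next (c i) _ ⟩
    ∑ F next (c i) + ∑ F (next + c i) (∑ c (suc i) rem)     ≡⟨ cong₂ _+_
        (∑-const next (c i) (φ i) λ k _ k< → cong φ (attach-here i rem next k<))
        (trans (∑-cong (next + c i) (∑ c (suc i) rem) λ k ≤k _ → cong φ (attach-later i rem next ≤k))
               (∑-attach φ (suc i) rem (next + c i))) ⟩
    c i * φ i + ∑ (λ k → c k * φ k) (suc i) rem             ∎
    where
    open ≡-Reasoning
    F : ℕ → ℕ
    F = φ ∘ attach c i (suc rem) next

attach-cong : ∀ {c c'} i rem next v → (∀ k → i ≤ k → c' k ≡ c k) → attach c' i rem next v ≡ attach c i rem next v
attach-cong i zero next v eq = refl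
attach-cong {c} {c'} i (suc rem) next v eq with v <? next + c i
... | yes v< = attach-here c' i rem next (subst (λ m → v < next + m) (sym c'i≡ci) v<)
  where c'i≡ci = eq i ≤-refl
... | no  v≮ = begin
  attach c' i (suc rem) next v            ≡⟨ attach-later c' i rem next (subst (λ m → next + m ≤ v) (sym c'i≡ci) (≮⇒≥ v≮)) ⟩
  attach c' (suc i) rem (next + c' i) v   ≡⟨ cong (λ m → attach c' (suc i) rem (next + m) v) c'i≡ci ⟩
  attach c' (suc i) rem (next + c i) v    ≡⟨ attach-cong (suc i) rem (next + c i) v (λ k i<k → eq k (<⇒≤ i<k)) ⟩
  attach c (suc i) rem (next + c i) v     ∎
  where
  open ≡-Reasoning
  c'i≡ci = eq i ≤-refl

module _ {c c' : ℕ → ℕ} {p : ℕ} (c'≡c : ∀ k → k ≢ p → k ≢ suc p → c' k ≡ c k)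
         (c-p : c p ≡ suc (c' p)) (c'-1+p : c' (suc p) ≡ suc (c (suc p))) where

  private
    next+c'p<next+cp : ∀ {next} → next + c' p < next + c p
    next+c'p<next+cp {next} = +-monoʳ-< next (subst (c' p <_) (sym c-p) (n<1+n (c' p)))

    next+cp≡ : ∀ {next} → next + c p ≡ suc (next + c' p)
    next+cp≡ {next} = trans (cong (next +_) c-p) (+-suc next (c' p))

    same-threshold : ∀ {next} → next + c' p + c' (suc p) ≡ next + c p + c (suc p)
    same-threshold {next} = begin
      next + c' p + c' (suc p)         ≡⟨ cong (next + c' p +_) c'-1+p ⟩
      next + c' p + suc (c (suc p))    ≡⟨ +-suc (next + c' p) _ ⟩
      suc (next + c' p) + c (suc p)    ≡⟨ cong (_+ c (suc p)) (sym (next+cp≡ {next})) ⟩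
      next + c p + c (suc p)           ∎
      where open ≡-Reasoning

    c'≡c-below : ∀ {k i} → suc k + i ≡ p → c' i ≡ c i
    c'≡c-below {k} {i} 1+k+i≡p = c'≡c i (<⇒≢ i<p) (<⇒≢ (m<n⇒m<1+n i<p))
      where
      i<p : i < p
      i<p = subst (i <_) 1+k+i≡p (s≤s (m≤n+m i k))

    ℓ'≡ℓ : ∀ {next i} k → next + c i + ∑ c (suc i) k + c' p ≡ next + ∑ c i (suc k) + c' p
    ℓ'≡ℓ {next} {i} k = cong (_+ c' p) (+-assoc next (c i) (∑ c (suc i) k))

  ∑-preserved : ∀ R → ∑ c' 0 (p + suc (suc R)) ≡ ∑ c 0 (p + suc (suc R))
  ∑-preserved R = begin
    ∑ c' 0 (p + suc (suc R))                                    ≡⟨ ∑-++ c' 0 p (suc (suc R)) ⟩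
    ∑ c' 0 p + (c' p + (c' (suc p) + ∑ c' (suc (suc p)) R))     ≡⟨ cong₂ _+_ below (cong (c' p +_) (cong₂ _+_ c'-1+p above)) ⟩
    ∑ c 0 p + (c' p + (suc (c (suc p)) + ∑ c (suc (suc p)) R))  ≡⟨ cong (∑ c 0 p +_) (+-suc (c' p) _) ⟩
    ∑ c 0 p + (suc (c' p) + (c (suc p) + ∑ c (suc (suc p)) R))
      ≡⟨ cong (λ m → ∑ c 0 p + (m + (c (suc p) + ∑ c (suc (suc p)) R))) (sym c-p) ⟩
    ∑ c 0 p + (c p + (c (suc p) + ∑ c (suc (suc p)) R))         ≡⟨ sym (∑-++ c 0 p (suc (suc R))) ⟩
    ∑ c 0 (p + suc (suc R))                                     ∎
    where
    open ≡-Reasoning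
    below : ∑ c' 0 p ≡ ∑ c 0 p
    below = ∑-cong 0 p λ k _ k<p → c'≡c k (<⇒≢ k<p) (<⇒≢ (m<n⇒m<1+n k<p))
    above : ∑ c' (suc (suc p)) R ≡ ∑ c (suc (suc p)) R
    above = ∑-cong (suc (suc p)) R λ k 2+p≤k _ → c'≡c k (>⇒≢ (≤-trans (n≤1+n (suc p)) 2+p≤k)) (>⇒≢ 2+p≤k)

  attach-past-p : ∀ {R next} v → attach c' (suc p) (suc R) (next + c' p) v ≡ attach c (suc p) (suc R) (next + c p) v
  attach-past-p {R} {next} v with <-≤-connex v (next + c p + c (suc p))
  ... | inj₁ v< = trans (attach-here c' (suc p) R (next + c' p) (subst (v <_) (sym threshold) v<))
                        (sym (attach-here c (suc p) R (next + c p) v<))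
    where threshold = same-threshold {next}
  ... | inj₂ ≤v = begin
    attach c' (suc p) (suc R) (next + c' p) v                 ≡⟨ attach-later c' (suc p) R (next + c' p) (subst (_≤ v) (sym threshold) ≤v) ⟩
    attach c' (suc (suc p)) R (next + c' p + c' (suc p)) v    ≡⟨ cong (λ m → attach c' (suc (suc p)) R m v) threshold ⟩
    attach c' (suc (suc p)) R (next + c p + c (suc p)) v      ≡⟨ attach-cong (suc (suc p)) R _ v beyond ⟩
    attach c (suc (suc p)) R (next + c p + c (suc p)) v       ≡⟨ sym (attach-later c (suc p) R (next + c p) ≤v) ⟩
    attach c (suc p) (suc R) (next + c p) v                   ∎
    where
    open ≡-Reasoning
    threshold = same-threshold {next}
    beyond : ∀ k → suc (suc p) ≤ k → c' k ≡ c k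
    beyond k 2+p≤k = c'≡c k (>⇒≢ (≤-trans (n≤1+n (suc p)) 2+p≤k)) (>⇒≢ 2+p≤k)

  attach-move-at-p : ∀ {R next} v →
                     attach c' p (suc (suc R)) next v ≡ attach c p (suc (suc R)) next v + δ (next + c' p) v
  attach-move-at-p {R} {next} v with <-cmp v (next + c' p)
  ... | tri< v<ℓ _ _ = begin
    attach c' p (suc (suc R)) next v                 ≡⟨ attach-here c' p (suc R) next v<ℓ ⟩
    p                                               ≡⟨ sym (+-identityʳ p) ⟩
    p + 0                                           ≡⟨ cong₂ _+_ (sym (attach-here c p (suc R) next (<-trans v<ℓ (next+c'p<next+cp {next}))))
                                                                 (sym (δ-other (<⇒≢ v<ℓ))) ⟩
    attach c p (suc (suc R)) next v + δ (next + c' p) v ∎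
    where open ≡-Reasoning
  ... | tri≈ _ refl _ = begin
    attach c' p (suc (suc R)) next v                 ≡⟨ attach-later c' p (suc R) next ≤-refl ⟩
    attach c' (suc p) (suc R) (next + c' p) v        ≡⟨ attach-here c' (suc p) R (next + c' p) (m<m+n v (subst (0 <_) (sym c'-1+p) z<s)) ⟩
    suc p                                           ≡⟨ +-comm 1 p ⟩
    p + 1                                           ≡⟨ cong₂ _+_ (sym (attach-here c p (suc R) next (next+c'p<next+cp {next}))) (sym (δ-self refl)) ⟩
    attach c p (suc (suc R)) next v + δ (next + c' p) v ∎
    where open ≡-Reasoning
  ... | tri> _ _ ℓ<v = begin
    attach c' p (suc (suc R)) next v                 ≡⟨ attach-later c' p (suc R) next (<⇒≤ ℓ<v) ⟩
    attach c' (suc p) (suc R) (next + c' p) v        ≡⟨ attach-past-p {R} {next} v ⟩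
    attach c (suc p) (suc R) (next + c p) v          ≡⟨ sym (attach-later c p (suc R) next next+cp≤v) ⟩
    attach c p (suc (suc R)) next v                  ≡⟨ sym (+-identityʳ _) ⟩
    attach c p (suc (suc R)) next v + 0              ≡⟨ cong (_ +_) (sym (δ-other (>⇒≢ ℓ<v))) ⟩
    attach c p (suc (suc R)) next v + δ (next + c' p) v ∎
    where
    open ≡-Reasoning
    next+cp≤v : next + c p ≤ v
    next+cp≤v = subst (_≤ v) (sym (next+cp≡ {next})) ℓ<v

  -- ℓ = next + ∑ c i k + c' p is the last leaf hung on p by c and the first one hung on p + 1 by c';
  -- every other leaf keeps its spine vertex.
  attach-move : ∀ k {i R next} v → k + i ≡ p →
                attach c' i (k + suc (suc R)) next v ≡ attach c i (k + suc (suc R)) next v + δ (next + ∑ c i k + c' p) v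
  attach-move zero {R = R} {next} v refl =
    trans (attach-move-at-p v) (cong (λ m → attach c p (suc (suc R)) next v + δ m v) (sym (cong (_+ c' p) (+-identityʳ next))))
  attach-move (suc k) {i} {R} {next} v 1+k+i≡p with <-≤-connex v (next + c i)
  ... | inj₁ v< = begin
    attach c' i (suc (k + suc (suc R))) next v ≡⟨ attach-here c' i _ next (subst (λ m → v < next + m) (sym (c'≡c-below 1+k+i≡p)) v<) ⟩
    i                                         ≡⟨ sym (+-identityʳ i) ⟩
    i + 0                                     ≡⟨ cong₂ _+_ (sym (attach-here c i _ next v<)) (sym (δ-other (<⇒≢ (<-≤-trans v< next+ci≤ℓ)))) ⟩
    attach c i (suc (k + suc (suc R))) next v + δ (next + ∑ c i (suc k) + c' p) v ∎
    where
    open ≡-Reasoning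
    next+ci≤ℓ : next + c i ≤ next + ∑ c i (suc k) + c' p
    next+ci≤ℓ = subst (next + c i ≤_) (ℓ'≡ℓ k) (≤-trans (m≤m+n _ (∑ c (suc i) k)) (m≤m+n _ (c' p)))
  ... | inj₂ ≤v = begin
    attach c' i (suc (k + suc (suc R))) next v
      ≡⟨ attach-later c' i _ next (subst (λ m → next + m ≤ v) (sym (c'≡c-below 1+k+i≡p)) ≤v) ⟩
    attach c' (suc i) (k + suc (suc R)) (next + c' i) v
      ≡⟨ cong (λ m → attach c' (suc i) (k + suc (suc R)) (next + m) v) (c'≡c-below 1+k+i≡p) ⟩
    attach c' (suc i) (k + suc (suc R)) (next + c i) v
      ≡⟨ attach-move k v (trans (+-suc k i) 1+k+i≡p) ⟩
    attach c (suc i) (k + suc (suc R)) (next + c i) v + δ (next + c i + ∑ c (suc i) k + c' p) v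
      ≡⟨ cong₂ _+_ (sym (attach-later c i _ next ≤v)) (cong (λ m → δ m v) (ℓ'≡ℓ k)) ⟩
    attach c i (suc (k + suc (suc R))) next v + δ (next + ∑ c i (suc k) + c' p) v ∎
    where open ≡-Reasoning

∈-leafEdges⁻ : ∀ {a next k e} → e ∈ leafEdges a next k → proj₁ e ≡ a × next ≤ proj₂ e × proj₂ e < next + k
∈-leafEdges⁻ {next = next} {suc k} (here refl) = refl , ≤-refl , m<m+n next z<s
∈-leafEdges⁻ {next = next} {suc k} {e} (there e∈) with ∈-leafEdges⁻ e∈
... | e₁≡a , 1+next≤e₂ , e₂< = e₁≡a , <⇒≤ 1+next≤e₂ , subst (proj₂ e <_) (sym (+-suc next k)) e₂<

∈-leafEdges⁺ : ∀ a {next k b} → next ≤ b → b < next + k → (a , b) ∈ leafEdges a next k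
∈-leafEdges⁺ a {next} {zero}  next≤b b< = contradiction (subst (_ <_) (+-identityʳ next) b<) (≤⇒≯ next≤b)
∈-leafEdges⁺ a {next} {suc k} {b} next≤b b< with next ≟ b
... | yes refl    = here refl
... | no  next≢b = there (∈-leafEdges⁺ a (≤∧≢⇒< next≤b next≢b) (subst (b <_) (+-suc next k) b<))

module Caterpillar (d : ℕ) (f : ℤ → ℕ) where

  c : ℕ → ℕ
  c i = f (pos d i)

  L : ℕ
  L = suc (2 * d)

  G : Graph
  G = caterpillar d f

  foot : ℕ → ℕ
  foot = attach c 0 L L

  open SpineMetric L public

  order-G : order G ≡ L + ∑ c 0 L
  order-G = cong (L +_) (sum-map-upTo c L)

  L≤order : L ≤ order G
  L≤order = subst (L ≤_) (sym order-G) (m≤m+n L _)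

  foot<L : ∀ v → foot v < L
  foot<L v = attach<B c 0 L L v ≤-refl z<s

  ∈-allLeafEdges⁻ : ∀ i rem next {a b} → (a , b) ∈ allLeafEdges d f i rem next → attach c i rem next b ≡ a × next ≤ b
  ∈-allLeafEdges⁻ i (suc rem) next {a} {b} e∈ with ∈-++⁻ (leafEdges i next (c i)) e∈
  ... | inj₁ e∈here with ∈-leafEdges⁻ e∈here
  ...   | refl , next≤b , b< = attach-here c i rem next b< , next≤b
  ∈-allLeafEdges⁻ i (suc rem) next {a} {b} e∈ | inj₂ e∈later with ∈-allLeafEdges⁻ (suc i) rem (next + c i) e∈later
  ...   | attach≡a , ≤b = trans (attach-later c i rem next ≤b) attach≡a , ≤-trans (m≤m+n next (c i)) ≤b

  ∈-allLeafEdges⁺ : ∀ i rem next {b} → next ≤ b → b < next + ∑ c i rem → (attach c i rem next b , b) ∈ allLeafEdges d f i rem next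
  ∈-allLeafEdges⁺ i zero next {b} next≤b b< = contradiction (subst (b <_) (+-identityʳ next) b<) (≤⇒≯ next≤b)
  ∈-allLeafEdges⁺ i (suc rem) next {b} next≤b b< with <-≤-connex b (next + c i)
  ... | inj₁ b<' = subst (λ a → (a , b) ∈ _) (sym (attach-here c i rem next b<'))
                     (∈-++⁺ˡ (∈-leafEdges⁺ i next≤b b<'))
  ... | inj₂ ≤b  = subst (λ a → (a , b) ∈ _) (sym (attach-later c i rem next ≤b))
                     (∈-++⁺ʳ (leafEdges i next (c i))
                       (∈-allLeafEdges⁺ (suc i) rem (next + c i) ≤b (subst (b <_) (sym (+-assoc next (c i) _)) b<)))

  spine-edge : ∀ {i} → i < 2 * d → (i , suc i) ∈ edges G
  spine-edge i< = ∈-++⁺ˡ (∈-map⁺ (λ i → (i , suc i)) (∈-upTo⁺ i<))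

  leaf-edge : ∀ {b} → L ≤ b → b < order G → (foot b , b) ∈ edges G
  leaf-edge {b} L≤b b< = ∈-++⁺ʳ (spineEdges d) (∈-allLeafEdges⁺ 0 L L L≤b (subst (b <_) order-G b<))

  ρ-edge : ∀ {a b} → (a , b) ∈ edges G → ρ foot a b ≡ 1
  ρ-edge e∈ with ∈-++⁻ (spineEdges d) e∈
  ... | inj₁ e∈spine with ∈-map⁻ (λ i → (i , suc i)) e∈spine
  ...   | i , i∈ , refl = begin
    ρ foot i (suc i)                             ≡⟨ ρ-from-spine foot i<L (<⇒≢ (n<1+n i)) ⟩
    depth (suc i) + ∣ i - base foot (suc i) ∣     ≡⟨ cong₂ (λ x y → x + ∣ i - y ∣) (depth-spine 1+i<L) (base-spine foot 1+i<L) ⟩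
    ∣ i - suc i ∣                                ≡⟨ ∣n-1+n∣≡1 i ⟩
    1                                           ∎
    where
    open ≡-Reasoning
    1+i<L : suc i < L
    1+i<L = s≤s (∈-upTo⁻ i∈)
    i<L : i < L
    i<L = <-trans (n<1+n i) 1+i<L
  ρ-edge {a} {b} e∈ | inj₂ e∈leaves with ∈-allLeafEdges⁻ 0 L L e∈leaves
  ... | foot-b≡a , L≤b = ρ-to-own-leaf foot (subst (_< L) foot-b≡a (foot<L b)) L≤b foot-b≡a

  ρ-adj : ∀ {u w} → T (adj G u w) → ρ foot u w ≡ 1
  ρ-adj {u} {w} t with find (any⁻ _ (edges G) t)
  ... | (a , b) , e∈ , t-ab with Equivalence.to T-∨ t-ab
  ...   | inj₁ t-uw with Equivalence.to T-∧ t-uw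
  ...     | a≡ᵇu , b≡ᵇw with ≡ᵇ⇒≡ a u a≡ᵇu | ≡ᵇ⇒≡ b w b≡ᵇw
  ...       | refl | refl = ρ-edge e∈
  ρ-adj {u} {w} t | (a , b) , e∈ , t-ab | inj₂ t-wu with Equivalence.to T-∧ t-wu
  ...     | a≡ᵇw , b≡ᵇu with ≡ᵇ⇒≡ a w a≡ᵇw | ≡ᵇ⇒≡ b u b≡ᵇu
  ...       | refl | refl = trans (ρ-sym foot u w) (ρ-edge e∈)

  adj-intro : ∀ {u w} → (u , w) ∈ edges G ⊎ (w , u) ∈ edges G → T (adj G u w)
  adj-intro {u} {w} (inj₁ e∈) =
    any⁺ _ (lose e∈ (Equivalence.from T-∨ (inj₁ (Equivalence.from T-∧ (≡⇒≡ᵇ u u refl , ≡⇒≡ᵇ w w refl)))))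
  adj-intro {u} {w} (inj₂ e∈) =
    any⁺ _ (lose e∈ (Equivalence.from T-∨ (inj₂ (Equivalence.from T-∧ (≡⇒≡ᵇ w w refl , ≡⇒≡ᵇ u u refl)))))

  Descent : ℕ → ℕ → Set
  Descent u v = ∃[ w ] w < order G × T (adj G u w) × ρ foot u v ≡ suc (ρ foot w v)

  private
    descent-leftward : ∀ {u v} → u < L → base foot v < u → u ≢ v → Descent u v
    descent-leftward {suc u'} {v} u<L b<u u≢v =
      u' , <-trans (n<1+n u') (<-≤-trans u<L L≤order) , adj-intro (inj₂ (spine-edge (s≤s⁻¹ u<L))) ,
      ρ-toward foot u<L (<-trans (n<1+n u') u<L) u≢v (∣1+m-n∣≡1+∣m-n∣ (s≤s⁻¹ b<u))

    descent-rightward : ∀ {u v} → u < L → u < base foot v → u ≢ v → Descent u v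
    descent-rightward {u} {v} u<L u<b u≢v =
      suc u , <-≤-trans 1+u<L L≤order , adj-intro (inj₁ (spine-edge (s≤s⁻¹ 1+u<L))) ,
      ρ-toward foot u<L 1+u<L u≢v (∣m-n∣≡1+∣1+m-n∣ u<b)
      where
      1+u<L : suc u < L
      1+u<L = ≤-<-trans u<b (base<L foot foot<L v)

    descent-to-own-leaf : ∀ {u v} → u < L → v < order G → base foot v ≡ u → u ≢ v → Descent u v
    descent-to-own-leaf {u} {v} u<L v<N b≡u u≢v =
      v , v<N , adj-intro (inj₁ (subst (λ a → (a , v) ∈ edges G) foot-v≡u (leaf-edge L≤v v<N))) ,
      trans (ρ-to-own-leaf foot u<L L≤v foot-v≡u) (cong suc (sym (ρ-refl foot v)))
      where
      L≤v : L ≤ v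
      L≤v = ≮⇒≥ λ v<L → u≢v (trans (sym b≡u) (base-spine foot v<L))
      foot-v≡u : foot v ≡ u
      foot-v≡u = trans (sym (base-leaf foot L≤v)) b≡u

  ρ-descent : ∀ {u v} → u < order G → v < order G → u ≢ v → Descent u v
  ρ-descent {u} {v} u<N v<N u≢v with u <? L
  ... | no u≮L = foot u , <-≤-trans (foot<L u) L≤order , adj-intro (inj₂ (leaf-edge (≮⇒≥ u≮L) u<N)) ,
                 ρ-leaf-descent foot foot<L (≮⇒≥ u≮L) u≢v
  ... | yes u<L with <-cmp (base foot v) u
  ...   | tri< b<u _ _ = descent-leftward u<L b<u u≢v
  ...   | tri≈ _ b≡u _ = descent-to-own-leaf u<L v<N b≡u u≢v
  ...   | tri> _ _ u<b = descent-rightward u<L u<b u≢v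

  open Geodesic G (ρ foot) (ρ-refl foot) (ρ-definite foot) (ρ-triangle foot) ρ-adj ρ-descent
                (ρ-bounded foot foot<L L≤order) public
    using (wiener≡∑<ρ)

  ∑-by-base : ∀ (φ : ℕ → ℕ) → ∑ (φ ∘ base foot) 0 (order G) ≡ ∑ (λ i → suc (c i) * φ i) 0 L
  ∑-by-base φ = begin
    ∑ (φ ∘ base foot) 0 (order G)                           ≡⟨ cong (∑ (φ ∘ base foot) 0) order-G ⟩
    ∑ (φ ∘ base foot) 0 (L + ∑ c 0 L)                       ≡⟨ ∑-++ (φ ∘ base foot) 0 L (∑ c 0 L) ⟩
    ∑ (φ ∘ base foot) 0 L + ∑ (φ ∘ base foot) L (∑ c 0 L)   ≡⟨ cong₂ _+_ spine leaves ⟩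
    ∑ φ 0 L + ∑ (λ i → c i * φ i) 0 L                       ≡⟨ sym (∑-+ φ (λ i → c i * φ i) 0 L) ⟩
    ∑ (λ i → suc (c i) * φ i) 0 L                           ∎
    where
    open ≡-Reasoning
    spine : ∑ (φ ∘ base foot) 0 L ≡ ∑ φ 0 L
    spine = ∑-cong 0 L λ k _ k<L → cong φ (base-spine foot k<L)
    leaves : ∑ (φ ∘ base foot) L (∑ c 0 L) ≡ ∑ (λ i → c i * φ i) 0 L
    leaves = trans (∑-cong L (∑ c 0 L) λ k L≤k _ → cong φ (base-leaf foot L≤k)) (∑-attach c φ 0 L L)

module _ {d : ℕ} {f f' : ℤ → ℕ} {p : ℕ} where
  private
    module A = Caterpillar d f
    module B = Caterpillar d f'
    open A using (L)
    c  = A.c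
    c' = B.c

  wiener-move-leaf : (∀ k → k ≢ p → k ≢ suc p → c' k ≡ c k) → c p ≡ suc (c' p) → c' (suc p) ≡ suc (c (suc p)) →
                     suc p < L →
                     wiener B.G + ∑ (suc ∘ c) (suc p) (L ∸ suc p) + 1 ≡ wiener A.G + ∑ (suc ∘ c) 0 (suc p)
  wiener-move-leaf c'≡c c-p c'-1+p 1+p<L = begin
    wiener B.G + ∑ (suc ∘ c) (suc p) (L ∸ suc p) + 1
      ≡⟨ cong₂ (λ w g → w + g + 1) (trans B.wiener≡∑<ρ (cong (∑< (B.ρ B.foot)) order≡))
                                   (sym (count (p <?_) (∑-*𝟙-> (suc ∘ c) p L p<L))) ⟩
    ∑< (B.ρ B.foot) N + ∑ (λ v → 𝟙 (p <? A.base A.foot v)) 0 N + 1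
      ≡⟨ SpineMetric.∑<ρ-transfer L L≤ℓ footℓ foot'ℓ foot'≡foot ℓ<N ⟩
    ∑< (A.ρ A.foot) N + ∑ (λ v → 𝟙 (A.base A.foot v ≤? p)) 0 N
      ≡⟨ cong₂ _+_ (sym A.wiener≡∑<ρ) (count (_≤? p) (∑-*𝟙-≤ (suc ∘ c) p L p<L)) ⟩
    wiener A.G + ∑ (suc ∘ c) 0 (suc p) ∎
    where
    open ≡-Reasoning
    N = order A.G
    p<L = <-trans (n<1+n p) 1+p<L
    R = L ∸ suc (suc p)
    L≡ : p + suc (suc R) ≡ L
    L≡ = trans (+-suc p (suc R)) (trans (cong suc (+-suc p R)) (m+[n∸m]≡n 1+p<L))
    ℓ = L + ∑ c 0 p + c' p
    L≤ℓ : L ≤ ℓ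
    L≤ℓ = ≤-trans (m≤m+n L _) (m≤m+n _ (c' p))
    c'p<cp : c' p < c p
    c'p<cp = subst (c' p <_) (sym c-p) (n<1+n (c' p))
    footℓ : A.foot ℓ ≡ p
    footℓ = trans (subst (λ m → attach c 0 m L ℓ ≡ p + 0) L≡ (attach-at c p {R = suc R} (m≤m+n _ (c' p)) ℓ<)) (+-identityʳ p)
      where
      ℓ< : ℓ < L + ∑ c 0 p + c (p + 0)
      ℓ< = subst (λ m → ℓ < L + ∑ c 0 p + c m) (sym (+-identityʳ p)) (+-monoʳ-< (L + ∑ c 0 p) c'p<cp)
    move : ∀ v → B.foot v ≡ A.foot v + δ ℓ v
    move v = subst (λ m → attach c' 0 m L v ≡ attach c 0 m L v + δ ℓ v) L≡ (attach-move c'≡c c-p c'-1+p p v (+-identityʳ p))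
    foot'ℓ : B.foot ℓ ≡ suc p
    foot'ℓ = trans (move ℓ) (trans (cong₂ _+_ footℓ (δ-self refl)) (+-comm p 1))
    foot'≡foot : ∀ v → v ≢ ℓ → B.foot v ≡ A.foot v
    foot'≡foot v v≢ℓ = trans (move v) (trans (cong (A.foot v +_) (δ-other v≢ℓ)) (+-identityʳ _))
    ∑c-split : ∑ c 0 L ≡ ∑ c 0 p + (c p + ∑ c (suc p) (suc R))
    ∑c-split = trans (cong (∑ c 0) (sym L≡)) (∑-++ c 0 p (suc (suc R)))
    ℓ<N : ℓ < N
    ℓ<N = subst (ℓ <_) (trans (cong (L +_) (sym ∑c-split)) (sym A.order-G))
            (<-≤-trans (+-monoʳ-< (L + ∑ c 0 p) c'p<cp)
                       (subst (_≤ L + (∑ c 0 p + (c p + ∑ c (suc p) (suc R)))) (sym (+-assoc L (∑ c 0 p) (c p)))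
                              (+-monoʳ-≤ L (+-monoʳ-≤ (∑ c 0 p) (m≤m+n (c p) _)))))
    order≡ : order B.G ≡ N
    order≡ = trans B.order-G (trans (cong (L +_) (subst (λ m → ∑ c' 0 m ≡ ∑ c 0 m) L≡ (∑-preserved c'≡c c-p c'-1+p R))) (sym A.order-G))
    count : ∀ {P : ℕ → Set} {X} (P? : ∀ b → Dec (P b)) →
            ∑ (λ i → suc (c i) * 𝟙 (P? i)) 0 L ≡ X → ∑ (λ v → 𝟙 (P? (A.base A.foot v))) 0 N ≡ X
    count P? eq = trans (A.∑-by-base (λ b → 𝟙 (P? b))) eq

pos-+ : ∀ d k → pos d (k + d) ≡ ℤ.+ k
pos-+ d k = trans (ℤₚ.m-n≡m⊖n (k + d) d) (trans (ℤₚ.⊖-≥ (m≤n+m d k)) (cong ℤ.+_ (m+n∸n≡m k d)))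

pos-pred : ∀ m → pos (suc m) m ≡ ℤ.-[1+ 0 ]
pos-pred m = trans (ℤₚ.⊖-< (n<1+n m)) (cong (λ k → ℤ.- (ℤ.+ k)) (m+n∸n≡m 1 m))

pos-injective : ∀ d {i j} → pos d i ≡ pos d j → i ≡ j
pos-injective d {i} {j} eq = ℤₚ.+-injective (trans (sym (shift i)) (trans (cong (λ z → z ℤ.+ ℤ.+ d) eq) (shift j)))
  where
  shift : ∀ k → pos d k ℤ.+ ℤ.+ d ≡ ℤ.+ k
  shift k = trans (ℤₚ.+-assoc (ℤ.+ k) (ℤ.- ℤ.+ d) (ℤ.+ d))
                  (trans (cong (λ z → ℤ.+ k ℤ.+ z) (ℤₚ.+-inverseˡ (ℤ.+ d))) (ℤₚ.+-identityʳ (ℤ.+ k)))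

∣pos∣ : ∀ d i → ℤ.∣ pos d i ∣ ≡ ∣ i - d ∣
∣pos∣ d i with d ≤? i
... | yes d≤i = begin
  ℤ.∣ pos d i ∣     ≡⟨ cong ℤ.∣_∣ (ℤₚ.m-n≡m⊖n i d) ⟩
  ℤ.∣ i ℤ.⊖ d ∣     ≡⟨ ℤₚ.∣m⊖n∣≡∣n⊖m∣ i d ⟩
  ℤ.∣ d ℤ.⊖ i ∣     ≡⟨ ℤₚ.∣⊖∣-≤ d≤i ⟩
  i ∸ d             ≡⟨ sym (m≤n⇒∣n-m∣≡n∸m d≤i) ⟩
  ∣ i - d ∣         ∎
  where open ≡-Reasoning
... | no d≰i = begin
  ℤ.∣ pos d i ∣     ≡⟨ cong ℤ.∣_∣ (ℤₚ.m-n≡m⊖n i d) ⟩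
  ℤ.∣ i ℤ.⊖ d ∣     ≡⟨ ℤₚ.∣⊖∣-≤ i≤d ⟩
  d ∸ i             ≡⟨ sym (m≤n⇒∣m-n∣≡n∸m i≤d) ⟩
  ∣ i - d ∣         ∎
  where
  open ≡-Reasoning
  i≤d = <⇒≤ (≰⇒> d≰i)

pos-indicator : ∀ d {j s} → pos d j ≡ s → ∀ i → (if ⌊ pos d i ℤₚ.≟ s ⌋ then 1 else 0) ≡ δ j i
pos-indicator d {j} {s} pos-j i with pos d i ℤₚ.≟ s
... | yes pos-i = sym (δ-self (pos-injective d (trans pos-i (sym pos-j))))
... | no  pos-i≢s = sym (δ-other λ i≡j → pos-i≢s (trans (cong (pos d) i≡j) pos-j))

module G₂-Family (n x e : ℕ) where

  d : ℕ
  d = suc (suc e)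

  r : ℕ
  r = rB (n ∸ 2) d x

  -- leavesB2 (n ∸ 2) d x j reduces to profile ℤ.∣ j ∣.
  profile : ℕ → ℕ
  profile a = if a ≡ᵇ d then r else if a ≡ᵇ (d ∸ 1) then x else if a ≤ᵇ (d ∸ 2) then 1 else 0

  b₂ : ℕ → ℕ
  b₂ i = profile ∣ i - d ∣

  leaf-count : ∀ j {s} → pos d j ≡ s → ∀ i → Caterpillar.c d (leavesG2 n d x s) i ≡ b₂ i + δ j i + δ (d + d) i
  leaf-count j pos-j i = cong₂ _+_ (cong₂ _+_ (cong profile (∣pos∣ d i)) (pos-indicator d pos-j i))
                             (pos-indicator d (pos-+ d d) i)

  profile-d : profile d ≡ r
  profile-d = if-true (≡⇒≡ᵇ d d refl)

  profile-d-1 : profile (suc e) ≡ x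
  profile-d-1 = trans (if-false λ t → <⇒≢ (n<1+n (suc e)) (≡ᵇ⇒≡ (suc e) d t)) (if-true (≡⇒≡ᵇ (suc e) (suc e) refl))

  profile-inner : ∀ {a} → a ≤ e → profile a ≡ 1
  profile-inner {a} a≤e = trans (if-false λ t → <⇒≢ (≤-<-trans a≤e (<-trans (n<1+n e) (n<1+n (suc e)))) (≡ᵇ⇒≡ a d t))
                         (trans (if-false λ t → <⇒≢ (s≤s a≤e) (≡ᵇ⇒≡ a (suc e) t)) (if-true (≤⇒≤ᵇ a≤e)))

  b₂-inner : ∀ {k} → 2 ≤ k → k ≤ 2 + (e + e) → b₂ k ≡ 1
  b₂-inner {suc (suc t)} (s≤s (s≤s z≤n)) (s≤s (s≤s t≤2e)) with ∣m-n∣≡[m∸n]∨[n∸m] t e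
  ... | inj₁ ∣t-e∣≡t∸e =
    profile-inner (subst (_≤ e) (sym ∣t-e∣≡t∸e) (subst (t ∸ e ≤_) (m+n∸n≡m e e) (∸-monoˡ-≤ e t≤2e)))
  ... | inj₂ ∣t-e∣≡e∸t = profile-inner (subst (_≤ e) (sym ∣t-e∣≡e∸t) (m∸n≤m e t))

  ∑-b₂-low : ∀ a → a ≤ suc (e + e) → ∑ b₂ 0 (2 + a) ≡ r + (x + a)
  ∑-b₂-low a a≤ = cong₂ _+_ profile-d (cong₂ _+_ profile-d-1 (trans (∑-const 2 a 1 inner) (*-identityʳ a)))
    where
    inner : ∀ k → 2 ≤ k → k < 2 + a → b₂ k ≡ 1
    inner k 2≤k k< = b₂-inner 2≤k (≤-trans (s≤s⁻¹ k<) (s≤s a≤))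

  ∑-b₂-high : ∀ a b → a + b ≡ suc (e + e) → ∑ b₂ (2 + a) (2 + b) ≡ b + (x + r)
  ∑-b₂-high a b a+b≡ = begin
    ∑ b₂ (2 + a) (2 + b)                       ≡⟨ cong (∑ b₂ (2 + a)) (+-comm 2 b) ⟩
    ∑ b₂ (2 + a) (b + 2)                       ≡⟨ ∑-++ b₂ (2 + a) b 2 ⟩
    ∑ b₂ (2 + a) b + ∑ b₂ (2 + a + b) 2        ≡⟨ cong₂ _+_ (trans (∑-const (2 + a) b 1 inner) (*-identityʳ b))
                                                            (cong (λ m → ∑ b₂ m 2) last-two) ⟩
    b + (b₂ (d + suc e) + (b₂ (suc (d + suc e)) + 0)) ≡⟨ cong (λ m → b + (m + (b₂ (suc (d + suc e)) + 0)))
                                                            (trans (cong profile (∣m+n-m∣≡n d (suc e))) profile-d-1) ⟩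
    b + (x + (b₂ (suc (d + suc e)) + 0))       ≡⟨ cong (λ m → b + (x + m)) (trans (+-identityʳ _) outermost) ⟩
    b + (x + r)                                ∎
    where
    open ≡-Reasoning
    2+a+b≡ : 2 + a + b ≡ 3 + (e + e)
    2+a+b≡ = trans (+-assoc 2 a b) (cong (λ m → 2 + m) a+b≡)
    last-two : 2 + a + b ≡ d + suc e
    last-two = trans 2+a+b≡ (solve 1 (λ e → con 3 :+ (e :+ e) := (con 2 :+ e) :+ (con 1 :+ e)) refl e)
    outermost : b₂ (suc (d + suc e)) ≡ r
    outermost = trans (cong b₂ (solve 1 (λ e → con 1 :+ ((con 2 :+ e) :+ (con 1 :+ e)) := (con 2 :+ e) :+ (con 2 :+ e)) refl e))
                      (trans (cong profile (∣m+n-m∣≡n d d)) profile-d)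
    inner : ∀ k → 2 + a ≤ k → k < 2 + a + b → b₂ k ≡ 1
    inner k 2+a≤k k< = b₂-inner (≤-trans (m≤m+n 2 a) 2+a≤k) (s≤s⁻¹ (subst (k <_) 2+a+b≡ k<))

  ∑-vertices : ∀ j {s} → pos d j ≡ s → ∀ a m →
             ∑ (suc ∘ Caterpillar.c d (leavesG2 n d x s)) a m ≡ m + (∑ b₂ a m + ∑ (δ j) a m + ∑ (δ (d + d)) a m)
  ∑-vertices j {s} pos-j a m = begin
    ∑ (suc ∘ Caterpillar.c d (leavesG2 n d x s)) a m             ≡⟨ ∑-cong a m (λ i _ _ → cong suc (leaf-count j pos-j i)) ⟩
    ∑ (λ i → suc (b₂ i + δ j i + δ (d + d) i)) a m               ≡⟨ ∑-suc (λ i → b₂ i + δ j i + δ (d + d) i) a m ⟩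
    m + ∑ (λ i → b₂ i + δ j i + δ (d + d) i) a m                 ≡⟨ cong (m +_) (trans (∑-+ _ (δ (d + d)) a m)
                                                                       (cong (_+ ∑ (δ (d + d)) a m) (∑-+ b₂ (δ j) a m))) ⟩
    m + (∑ b₂ a m + ∑ (δ j) a m + ∑ (δ (d + d)) a m)             ∎
    where open ≡-Reasoning

  module _ {p s s'} (pos-s : pos d p ≡ s) (pos-s' : pos d (suc p) ≡ s') where
    private
      c c' : ℕ → ℕ
      c  = Caterpillar.c d (leavesG2 n d x s)
      c' = Caterpillar.c d (leavesG2 n d x s')

      bump : ∀ {k j} → k ≢ j → b₂ k + δ k k + δ (d + d) k ≡ suc (b₂ k + δ j k + δ (d + d) k)
      bump {k} k≢j = trans (cong (λ t → b₂ k + t + δ (d + d) k) (δ-self refl))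
        (trans (solve 2 (λ b y → b :+ con 1 :+ y := con 1 :+ (b :+ con 0 :+ y)) refl (b₂ k) (δ (d + d) k))
               (cong (λ t → suc (b₂ k + t + δ (d + d) k)) (sym (δ-other k≢j))))

    moved-elsewhere : ∀ k → k ≢ p → k ≢ suc p → c' k ≡ c k
    moved-elsewhere k k≢p k≢1+p = trans (leaf-count (suc p) pos-s' k)
      (trans (cong (λ t → b₂ k + t + δ (d + d) k) (trans (δ-other k≢1+p) (sym (δ-other k≢p)))) (sym (leaf-count p pos-s k)))

    moved-from : c p ≡ suc (c' p)
    moved-from = trans (leaf-count p pos-s p) (trans (bump (<⇒≢ (n<1+n p))) (cong suc (sym (leaf-count (suc p) pos-s' p))))

    moved-to : c' (suc p) ≡ suc (c (suc p))
    moved-to = trans (leaf-count (suc p) pos-s' (suc p)) (trans (bump (>⇒≢ (n<1+n p))) (cong suc (sym (leaf-count p pos-s (suc p)))))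

  module Split (a b : ℕ) (a+b+3≡ : a + b + 3 ≡ d + d) where

    L≡ : suc (2 * d) ≡ 2 + a + (2 + b)
    L≡ = trans (cong suc (trans (cong (d +_) (+-identityʳ d)) (sym a+b+3≡)))
               (solve 2 (λ a b → con 1 :+ (a :+ b :+ con 3) := con 2 :+ a :+ (con 2 :+ b)) refl a b)

    private
      a+b≡ : a + b ≡ suc (e + e)
      a+b≡ = +-cancelʳ-≡ 3 _ _ (trans a+b+3≡ (solve 1 (λ e → (con 2 :+ e) :+ (con 2 :+ e) := con 1 :+ (e :+ e) :+ con 3) refl e))

      2+a≤2d : 2 + a ≤ d + d
      2+a≤2d = subst (2 + a ≤_) (trans (solve 2 (λ a b → con 2 :+ a :+ (con 1 :+ b) := a :+ b :+ con 3) refl a b) a+b+3≡)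
                     (m≤m+n (2 + a) (1 + b))

      2d<L : d + d < 2 + a + (2 + b)
      2d<L = subst (d + d <_) L≡ (subst (λ m → d + d < suc m) (cong (d +_) (sym (+-identityʳ d))) ≤-refl)

    ∑-vertices-left : ∀ {s} → pos d (suc a) ≡ s →
                      ∑ (suc ∘ Caterpillar.c d (leavesG2 n d x s)) 0 (2 + a) ≡ 2 + a + (r + (x + a) + 1 + 0)
    ∑-vertices-left pos-s = trans (∑-vertices (suc a) pos-s 0 (2 + a))
      (cong (2 + a +_) (cong₂ _+_ (cong₂ _+_ (∑-b₂-low a (≤-trans (m≤m+n a b) (≤-reflexive a+b≡)))
                                             (∑-δ-in (suc a) 0 (2 + a) z≤n ≤-refl))
                                  (∑-δ-out (d + d) 0 (2 + a) (inj₂ 2+a≤2d))))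

    ∑-vertices-right : ∀ {s} → pos d (suc a) ≡ s →
                       ∑ (suc ∘ Caterpillar.c d (leavesG2 n d x s)) (2 + a) (2 + b) ≡ 2 + b + (b + (x + r) + 0 + 1)
    ∑-vertices-right pos-s = trans (∑-vertices (suc a) pos-s (2 + a) (2 + b))
      (cong (2 + b +_) (cong₂ _+_ (cong₂ _+_ (∑-b₂-high a b a+b≡) (∑-δ-out (suc a) (2 + a) (2 + b) (inj₁ ≤-refl)))
                                  (∑-δ-in (d + d) (2 + a) (2 + b) 2+a≤2d 2d<L)))

  -- G₂(n,d,x,s') is G₂(n,d,x,s) with the extra leaf moved from u_s (spine vertex a + 1) to u_s'.
  wiener-G₂-step : ∀ a b {s s'} → a + b + 3 ≡ d + d → pos d (suc a) ≡ s → pos d (suc (suc a)) ≡ s' →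
                   wiener (G₂ n d x s') + (2 * b + 1) ≡ wiener (G₂ n d x s) + 2 * a
  wiener-G₂-step a b {s} {s'} a+b+3≡ pos-s pos-s' = +-cancelʳ-≡ (x + r + 3) _ _ (begin
    W' + (2 * b + 1) + (x + r + 3)                 ≡⟨ solve 4 (λ w b x r → w :+ (con 2 :* b :+ con 1) :+ (x :+ r :+ con 3)
                                                        := w :+ (con 2 :+ b :+ (b :+ (x :+ r) :+ con 0 :+ con 1)) :+ con 1) refl W' b x r ⟩
    W' + (2 + b + (b + (x + r) + 0 + 1)) + 1       ≡⟨ cong (λ t → W' + t + 1) (sym right) ⟩
    W' + ∑ (suc ∘ c) (2 + a) (L ∸ (2 + a)) + 1     ≡⟨ wiener-move-leaf {d} {leavesG2 n d x s} {leavesG2 n d x s'} {suc a}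
                                                        (moved-elsewhere {suc a} pos-s pos-s') (moved-from {suc a} pos-s pos-s')
                                                        (moved-to {suc a} pos-s pos-s') 2+a<L ⟩
    W + ∑ (suc ∘ c) 0 (2 + a)                      ≡⟨ cong (W +_) (∑-vertices-left pos-s) ⟩
    W + (2 + a + (r + (x + a) + 1 + 0))            ≡⟨ solve 4 (λ w a x r → w :+ (con 2 :+ a :+ (r :+ (x :+ a) :+ con 1 :+ con 0))
                                                        := w :+ con 2 :* a :+ (x :+ r :+ con 3)) refl W a x r ⟩
    W + 2 * a + (x + r + 3)                        ∎)
    where
    open ≡-Reasoning
    open Split a b a+b+3≡
    W  = wiener (G₂ n d x s)
    W' = wiener (G₂ n d x s')
    c  = Caterpillar.c d (leavesG2 n d x s)
    L  = suc (2 * d)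
    2+a<L : 2 + a < L
    2+a<L = subst (2 + a <_) (sym L≡) (m<m+n (2 + a) z<s)
    right : ∑ (suc ∘ c) (2 + a) (L ∸ (2 + a)) ≡ 2 + b + (b + (x + r) + 0 + 1)
    right = trans (cong (∑ (suc ∘ c) (2 + a)) (trans (cong (_∸ (2 + a)) L≡) (m+n∸m≡n (2 + a) (2 + b))))
                  (∑-vertices-right pos-s)

open import Data.Integer using (+_; -[1+_])

mainTheorem9 : (n d x : ℕ) → 2 ∣ n → 18 ≤ n ∸ 2 → 4 ≤ d → d ≤ (n ∸ 2) / 4 → 1 ≤ x → 2 * x ≤ (n ∸ 2) + 2 ∸ 4 * d →
    (wiener (G₂ n d x (+ 1)) ≡ wiener (G₂ n d x (+ 0)) + 1)
    × (wiener (G₂ n d x (+ 2)) ≡ wiener (G₂ n d x (+ 0)) + 6)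
    × (wiener (G₂ n d x -[1+ 0 ]) ≡ wiener (G₂ n d x (+ 0)) + 3)
mainTheorem9 n .(4 + k) x _ _ (s≤s (s≤s (s≤s (s≤s {n = k} _)))) _ _ _ = W₁≡ , W₂≡ , W₋₁≡
  where
  open G₂-Family n x (2 + k)
  W : ℤ → ℕ
  W s = wiener (G₂ n d x s)
  W₁≡ : W (+ 1) ≡ W (+ 0) + 1
  W₁≡ = cancel-offset (2 * (2 + k) + 1) (2 * (3 + k)) 1
          (wiener-G₂-step (3 + k) (2 + k) (solve 1 (λ k → con 3 :+ k :+ (con 2 :+ k) :+ con 3 := (con 4 :+ k) :+ (con 4 :+ k)) refl k)
                       (pos-+ d 0) (pos-+ d 1))
          (solve 1 (λ k → con 2 :* (con 3 :+ k) := con 1 :+ (con 2 :* (con 2 :+ k) :+ con 1)) refl k)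
  W₂≡W₁+5 : W (+ 2) ≡ W (+ 1) + 5
  W₂≡W₁+5 = cancel-offset (2 * (1 + k) + 1) (2 * (4 + k)) 5
          (wiener-G₂-step (4 + k) (1 + k) (solve 1 (λ k → con 4 :+ k :+ (con 1 :+ k) :+ con 3 := (con 4 :+ k) :+ (con 4 :+ k)) refl k)
                       (pos-+ d 1) (pos-+ d 2))
          (solve 1 (λ k → con 2 :* (con 4 :+ k) := con 5 :+ (con 2 :* (con 1 :+ k) :+ con 1)) refl k)
  W₂≡ : W (+ 2) ≡ W (+ 0) + 6
  W₂≡ = trans W₂≡W₁+5 (trans (cong (λ w → w + 5) W₁≡) (+-assoc (W (+ 0)) 1 5))
  W₋₁≡ : W -[1+ 0 ] ≡ W (+ 0) + 3
  W₋₁≡ = cancel-offset (2 * (2 + k)) (2 * (3 + k) + 1) 3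
          (sym (wiener-G₂-step (2 + k) (3 + k) (solve 1 (λ k → con 2 :+ k :+ (con 3 :+ k) :+ con 3 := (con 4 :+ k) :+ (con 4 :+ k)) refl k)
                            (pos-pred (3 + k)) (pos-+ d 0)))
          (solve 1 (λ k → con 2 :* (con 3 :+ k) :+ con 1 := con 3 :+ con 2 :* (con 2 :+ k)) refl k)
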